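{- For every $\mathcal{S}_1,\mathcal{S}_2\subseteq 2^{[n]}$, $\mathrm{HHdim}(\mathcal{S}_1\cup\mathcal{S}_2)\le\mathrm{HHdim}(\mathcal{S}_1)+\mathrm{HHdim}(\mathcal{S}_2)$.
   Context: Subsets are identified with $0/1$ vectors; $u\circ v$ is the coordinatewise product and $\operatorname{supp}(v)=\{i:v_i\ne0\}$. $H(\mathcal{S},v)=\{i\in[n]:\exists s\in\mathcal{S}\text{ with }\operatorname{supp}(s\circ v)=\{i\}\}$ and $\mathrm{HHdim}(\mathcal{S})=\sup_{v\in\mathbb{R}^n}|H(\mathcal{S},v)|$.
   Formalization: The vector v in $H(\mathcal{S},v)$ and in the supremum defining HHdim ranges over ℚ^n instead of ℝ^n. -}

module Defs where

open import Data.Nat using (ℕ; _≤_; _+_)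
open import Data.Bool using (Bool; true; false; not; if_then_else_)
open import Data.Fin using (Fin)
open import Data.Fin.Subset using (Subset; ⁅_⁆; ∣_∣)
open import Data.Vec using (Vec; lookup; tabulate)
open import Data.Vec.Properties using (≡-dec)
open import Data.Bool.Properties using () renaming (_≟_ to _≟B_)
open import Data.List using (List; _++_)
open import Data.Bool.ListAction using (any)
open import Data.Rational using (ℚ; 0ℚ; 1ℚ; _*_; _≟_)
open import Data.Product using (Σ; _×_)
open import Relation.Nullary using (does)
open import Relation.Binary.PropositionalEquality using (_≡_)

-- A vector in ℚ^n (stands in for ℝ^n).
Vecℚ : ℕ → Set
Vecℚ n = Fin n → ℚ

indicator : {n : ℕ} → Subset n → Vecℚ n
indicator s j = if lookup s j then 1ℚ else 0ℚ

_∘ᵥ_ : {n : ℕ} → Vecℚ n → Vecℚ n → Vecℚ n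
(u ∘ᵥ v) j = u j * v j

supp : {n : ℕ} → Vecℚ n → Subset n
supp v = tabulate λ j → not (does (v j ≟ 0ℚ))

Family : ℕ → Set
Family n = List (Subset n)

_∪ᶠ_ : {n : ℕ} → Family n → Family n → Family n
S₁ ∪ᶠ S₂ = S₁ ++ S₂

H : {n : ℕ} → Family n → Vecℚ n → Subset n
H S v = tabulate λ i →
  any (λ s → does (≡-dec _≟B_ (supp (indicator s ∘ᵥ v)) ⁅ i ⁆)) S

-- d = HHdim(𝒮) = sup_{v} |H(𝒮,v)|  (the sup is attained since |H| ≤ n)
IsHHdim : {n : ℕ} → Family n → ℕ → Set
IsHHdim S d = ((v : Vecℚ _) → ∣ H S v ∣ ≤ d) × Σ (Vecℚ _) (λ v → ∣ H S v ∣ ≡ d)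

{-# OPTIONS --safe #-}
-- A coordinate i is hit by S₁ ∪ S₂ at v exactly when it is hit by S₁ or by S₂ at v, so
-- H(S₁ ∪ S₂, v) = H(S₁, v) ∪ H(S₂, v); taking v attaining HHdim(S₁ ∪ S₂), subadditivity
-- of cardinality under union bounds it by HHdim(S₁) + HHdim(S₂).
module Submission where

open import Defs
open import Data.Nat using (ℕ; zero; suc; _≤_; _+_; z≤n; s≤s)
open import Data.Nat.Properties
  using (≤-trans; ≤-reflexive; +-suc; +-monoʳ-≤; +-mono-≤; n≤1+n; module ≤-Reasoning)
open import Data.Bool using (Bool; _∨_)
open import Data.Bool.Properties using (∨-assoc)
open import Data.Bool.ListAction using (any)
open import Data.Fin using (Fin)
open import Data.Fin.Subset using (Subset; _∪_; ∣_∣; inside; outside)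
open import Data.Vec using ([]; _∷_; tabulate; zipWith)
open import Data.Vec.Properties using (tabulate-cong)
open import Data.List using (List; []; _∷_; _++_)
open import Data.Product using (_,_)
open import Function using (_∘_)
open import Relation.Binary.PropositionalEquality using (_≡_; refl; sym; trans; cong)

any-++ : {A : Set} (p : A → Bool) (xs ys : List A) → any p (xs ++ ys) ≡ any p xs ∨ any p ys
any-++ p []       ys = refl
any-++ p (x ∷ xs) ys =
  trans (cong (p x ∨_) (any-++ p xs ys)) (sym (∨-assoc (p x) (any p xs) (any p ys)))

zipWith-tabulate : {A B C : Set} {n : ℕ} (f : A → B → C) (g : Fin n → A) (h : Fin n → B) →
                   zipWith f (tabulate g) (tabulate h) ≡ tabulate (λ i → f (g i) (h i))
zipWith-tabulate {n = zero}  f g h = refl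
zipWith-tabulate {n = suc n} f g h =
  cong (f (g Fin.zero) (h Fin.zero) ∷_) (zipWith-tabulate f (g ∘ Fin.suc) (h ∘ Fin.suc))

∣p∪q∣≤∣p∣+∣q∣ : {n : ℕ} (p q : Subset n) → ∣ p ∪ q ∣ ≤ ∣ p ∣ + ∣ q ∣
∣p∪q∣≤∣p∣+∣q∣ []            []            = z≤n
∣p∪q∣≤∣p∣+∣q∣ (outside ∷ p) (outside ∷ q) = ∣p∪q∣≤∣p∣+∣q∣ p q
∣p∪q∣≤∣p∣+∣q∣ (outside ∷ p) (inside  ∷ q) = ≤-trans (s≤s (∣p∪q∣≤∣p∣+∣q∣ p q)) (≤-reflexive (sym (+-suc ∣ p ∣ ∣ q ∣)))
∣p∪q∣≤∣p∣+∣q∣ (inside  ∷ p) (outside ∷ q) = s≤s (∣p∪q∣≤∣p∣+∣q∣ p q)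
∣p∪q∣≤∣p∣+∣q∣ (inside  ∷ p) (inside  ∷ q) = s≤s (≤-trans (∣p∪q∣≤∣p∣+∣q∣ p q) (+-monoʳ-≤ ∣ p ∣ (n≤1+n ∣ q ∣)))

H-∪ᶠ : {n : ℕ} (S₁ S₂ : Family n) (v : Vecℚ n) → H (S₁ ∪ᶠ S₂) v ≡ H S₁ v ∪ H S₂ v
H-∪ᶠ S₁ S₂ v = trans (tabulate-cong (λ i → any-++ _ S₁ S₂)) (sym (zipWith-tabulate _∨_ _ _))

mainTheorem11 : (n : ℕ) (S₁ S₂ : Family n) (d₁ d₂ d : ℕ) →
    IsHHdim S₁ d₁ → IsHHdim S₂ d₂ → IsHHdim (S₁ ∪ᶠ S₂) d → d ≤ d₁ + d₂
mainTheorem11 n S₁ S₂ d₁ d₂ d (bounded₁ , _) (bounded₂ , _) (_ , v , attained) = begin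
  d                         ≡⟨ sym attained ⟩
  ∣ H (S₁ ∪ᶠ S₂) v ∣        ≡⟨ cong ∣_∣ (H-∪ᶠ S₁ S₂ v) ⟩
  ∣ H S₁ v ∪ H S₂ v ∣       ≤⟨ ∣p∪q∣≤∣p∣+∣q∣ (H S₁ v) (H S₂ v) ⟩
  ∣ H S₁ v ∣ + ∣ H S₂ v ∣   ≤⟨ +-mono-≤ (bounded₁ v) (bounded₂ v) ⟩
  d₁ + d₂                   ∎
  where open ≤-Reasoning
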